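{- Let $d\ge2$ and $n\ge0$. The set $S^{d-1}_n\big((21,12),231\big)$ of $d$-permutations of size $n$ avoiding both the pattern $(21,12)$ and the pattern $231$ is in bijection with the set of $d$-ary trees with $n$ internal nodes.
   Context: A $d$-permutation of size $n$ is a tuple $\boldsymbol{\sigma}=(\sigma_1,\ldots,\sigma_{d-1})$ of permutations of $[n]$; put $\sigma_0=\mathrm{id}$. Its points are $(i,\sigma_1(i),\ldots,\sigma_{d-1}(i))$, $i\in[n]$, and $\sigma_l(p)$ is the $l$-th coordinate ($l=0,\ldots,d-1$) of point $p$. Pattern avoidance: for indices $0\le i_1<\cdots<i_{d'}\le d-1$ the (direct) projection is the $d'$-permutation $(\sigma_{i_2}\sigma_{i_1}^{ -1},\ldots,\sigma_{i_{d'}}\sigma_{i_1}^{ -1})$. $\boldsymbol\sigma$ contains a $d'$-permutation $\boldsymbol\tau=(\tau_1,\ldots,\tau_{d'-1})$ of size $k$ if some direct projection $\boldsymbol\sigma'$ of dimension $d'$ and indices $c_1<\cdots<c_k$ satisfy: $\sigma'_m(c_1)\cdots\sigma'_m(c_k)$ is order-isomorphic to $\tau_m$ for all $m$; otherwise it avoids $\boldsymbol\tau$. Here $(21,12)$ is the $3$-permutation of size $2$ with $\tau_1=21$, $\tau_2=12$: $\boldsymbol\sigma$ contains it iff there are points $p,q$ and indices $0\le i<j<k\le d-1$ with $\sigma_i(p)<\sigma_i(q)$, $\sigma_j(p)>\sigma_j(q)$, $\sigma_k(p)<\sigma_k(q)$. The pattern $231$ is the ordinary permutation (2-permutation) of size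 3: $\boldsymbol\sigma$ contains it iff there are $0\le i<j\le d-1$ and points $a,b,c$ with $\sigma_i(a)<\sigma_i(b)<\sigma_i(c)$ and $\sigma_j(c)<\sigma_j(a)<\sigma_j(b)$. A $d$-ary tree is a rooted tree in which each node has either $0$ or $d$ distinguishable (ordered) children; nodes with children are internal. -}

module Defs where

open import Data.Nat using (ℕ; zero; suc; _+_)
open import Data.Fin using (Fin; zero; suc; _<_)
open import Data.Vec using (Vec; []; _∷_; lookup)
open import Data.Vec.Relation.Unary.All using (All)
open import Data.Product using (Σ; ∃-syntax; _×_; proj₁)
open import Data.Unit using (⊤)
import Agda.Primitive
open import Relation.Nullary using (¬_)
open import Relation.Binary.PropositionalEquality using (_≡_)
open import Relation.Binary.Bundles using (Setoid)
open import Relation.Binary.PropositionalEquality.Properties using () renaming (setoid to ≡-setoid)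
import Relation.Binary.Construct.On as On
open import Function.Bundles using (Bijection)

IsPerm : {n : ℕ} → Vec (Fin n) n → Set
IsPerm {n} r = (i j : Fin n) → lookup r i ≡ lookup r j → i ≡ j

-- Raw data of a d-permutation of size n: the d-1 permutations σ₁ … σ_{d-1}.
DRows : ℕ → ℕ → Set
DRows zero    n = ⊤
DRows (suc k) n = Vec (Vec (Fin n) n) k

IsDPerm : {d n : ℕ} → DRows d n → Set
IsDPerm {zero}  _ = ⊤
IsDPerm {suc k} σ = All IsPerm σ

coord : {d n : ℕ} → DRows d n → Fin d → Fin n → Fin n
coord {suc k} σ zero    p = p
coord {suc k} σ (suc l) p = lookup (lookup σ l) p

Contains-21-12 : {d n : ℕ} → DRows d n → Set
Contains-21-12 {d} {n} σ =
  ∃[ p ] ∃[ q ] ∃[ i ] ∃[ j ] ∃[ k ]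
    (i < j × j < k ×
     coord σ i p < coord σ i q × coord σ j q < coord σ j p × coord σ k p < coord σ k q)

Contains-231 : {d n : ℕ} → DRows d n → Set
Contains-231 {d} {n} σ =
  ∃[ i ] ∃[ j ] ∃[ a ] ∃[ b ] ∃[ c ]
    (i < j ×
     coord σ i a < coord σ i b × coord σ i b < coord σ i c ×
     coord σ j c < coord σ j a × coord σ j a < coord σ j b)

S-21-12-231 : ℕ → ℕ → Set
S-21-12-231 d n = Σ (DRows d n) λ σ → IsDPerm σ × ¬ Contains-21-12 σ × ¬ Contains-231 σ

data Tree (d : ℕ) : Set where
  leaf : Tree d
  node : Vec (Tree d) d → Tree d

mutual
  internal : {d : ℕ} → Tree d → ℕ
  internal leaf        = 0
  internal (node ts)   = suc (internalsV ts)

  internalsV : {d m : ℕ} → Vec (Tree d) m → ℕ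
  internalsV []       = 0
  internalsV (t ∷ ts) = internal t + internalsV ts

TreesWith : ℕ → ℕ → Set
TreesWith d n = Σ (Tree d) λ t → internal t ≡ n

-- Setoid on a subset type Σ A P: elements equal iff their underlying A-values are equal
-- (the property proofs are irrelevant, as for a set {x ∈ A | P x}).
SubsetSetoid : (A : Set) (P : A → Set) → Setoid Agda.Primitive.lzero Agda.Primitive.lzero
SubsetSetoid A P = On.setoid {B = Σ A P} (≡-setoid A) proj₁

{-# OPTIONS --safe #-}
module Submission where

-- Order the points of a d-permutation by their first coordinate and make the first point r
-- the root. Every other point x goes to subtree number level r x, the number of leading
-- coordinates in which r precedes x, and the subtrees are encoded recursively. Avoiding
-- (21,12) makes the coordinates in which r precedes x an initial segment, so x precedes r
-- exactly in the coordinates l ≥ level r x. Avoiding 231 then forces a point of smaller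
-- level to precede a point of larger level in every coordinate; in particular the subtrees
-- occupy consecutive blocks of points. Hence, replacing every point by the path from the
-- root to its node turns the d orders on the points into orders on paths that depend only
-- on the tree, so the tree determines the d-permutation. Conversely the paths of the
-- internal nodes of any tree avoid both patterns, and ranking them in every coordinate
-- gives a d-permutation whose encoding is that tree.

open import Defs
open import Data.Nat using (ℕ; _≤_)
open import Data.Product using (_×_)
open import Relation.Nullary using (¬_)
open import Relation.Binary.PropositionalEquality using (_≡_)
open import Function.Bundles using (Bijection)

open import Data.Nat using (zero; suc; _+_; _<_; _≟_; z≤n; s≤s; z<s; s<s; s<s⁻¹)
import Data.Nat.Properties as ℕ
open import Data.Fin as Fin using (Fin; zero; suc; toℕ; fromℕ<)
import Data.Fin.Properties as Fin
open import Data.List using (List; []; _∷_; _++_; map; length; lookup; takeWhile; dropWhile; filter; allFin)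
import Data.List.Properties as List
open import Data.List.Relation.Unary.All as All using (All; []; _∷_)
import Data.List.Relation.Unary.All.Properties as All
open import Data.List.Relation.Unary.AllPairs as AllPairs using (AllPairs; []; _∷_)
import Data.List.Relation.Unary.AllPairs.Properties as AllPairs
open import Data.List.Relation.Unary.Any as Any using (here; there)
open import Data.List.Membership.Propositional using (_∈_)
open import Data.List.Membership.Propositional.Properties using (∈-allFin; ∈-map⁻; ∈-lookup)
open import Data.List.Relation.Binary.Sublist.Propositional using (_⊆_; []; _∷_; _∷ʳ_)
open import Data.List.Relation.Binary.Sublist.Propositional.Properties
  using (takeWhile-⊆; dropWhile-⊆; length-mono-≤; All-resp-⊆)
open import Data.Vec as Vec using (Vec; []; _∷_)
import Data.Vec.Properties as Vec
import Data.Vec.Relation.Unary.All.Properties as VecAll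
open import Data.Product using (Σ-syntax; ∃₂; ∃-syntax; _,_; proj₁; proj₂; map₂; swap)
open import Data.Sum using (_⊎_; inj₁; inj₂)
import Data.Sum
open import Data.Empty using (⊥; ⊥-elim)
open import Data.Bool using (true; false)
open import Function using (_∘_; _⇔_; mk⇔; Equivalence)
import Function
open import Function.Construct.Composition using (_⇔-∘_)
open import Function.Construct.Symmetry using (⇔-sym)
open import Relation.Nullary using (Dec; yes; no; does; contradiction)
open import Relation.Nullary.Decidable using (dec-true; dec-false; does-⇔)
open import Level using (0ℓ)
open import Relation.Unary using (Pred; Decidable; ∁)
open import Relation.Binary.Definitions using (Tri; tri<; tri≈; tri>)
open import Relation.Binary.PropositionalEquality
  using (_≢_; refl; sym; trans; cong; cong₂; subst; subst₂; module ≡-Reasoning)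

open Equivalence using (to; from)


prefixLength : ∀ {m} {P : Pred (Fin m) 0ℓ} → Decidable P → ℕ
prefixLength {zero}  P? = 0
prefixLength {suc m} P? with P? zero
... | yes _ = suc (prefixLength (λ i → P? (suc i)))
... | no  _ = 0

prefixLength-≤ : ∀ {m} {P : Pred (Fin m) 0ℓ} (P? : Decidable P) → prefixLength P? ≤ m
prefixLength-≤ {zero}  P? = z≤n
prefixLength-≤ {suc m} P? with P? zero
... | yes _ = s≤s (prefixLength-≤ (λ i → P? (suc i)))
... | no  _ = z≤n

prefixLength-spec : ∀ {m} {P : Pred (Fin m) 0ℓ} (P? : Decidable P) →
                    (∀ {i j} → i Fin.≤ j → P j → P i) →
                    ∀ i → P i ⇔ toℕ i < prefixLength P?
prefixLength-spec {suc m} P? closed zero with P? zero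
... | yes p = mk⇔ (λ _ → z<s) (λ _ → p)
... | no ¬p = mk⇔ (λ p → contradiction p ¬p) (λ ())
prefixLength-spec {suc m} P? closed (suc i) with P? zero
... | yes _ = mk⇔ (s<s ∘ to ih) (from ih ∘ s<s⁻¹)
  where ih = prefixLength-spec (λ i → P? (suc i)) (λ i≤j → closed (s≤s i≤j)) i
... | no ¬p = mk⇔ (λ p → contradiction (closed z≤n p) ¬p) (λ ())

prefixLength-cong : ∀ {m} {P Q : Pred (Fin m) 0ℓ} (P? : Decidable P) (Q? : Decidable Q) →
                    (∀ i → P i ⇔ Q i) → prefixLength P? ≡ prefixLength Q?
prefixLength-cong {zero}  P? Q? P⇔Q = refl
prefixLength-cong {suc m} P? Q? P⇔Q with P? zero | Q? zero
... | yes _ | yes _  = cong suc (prefixLength-cong (λ i → P? (suc i)) (λ i → Q? (suc i)) (P⇔Q ∘ suc))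
... | no _  | no _   = refl
... | yes p | no ¬q  = contradiction (to (P⇔Q zero) p) ¬q
... | no ¬p | yes q  = contradiction (from (P⇔Q zero) q) ¬p

prefixLength-≡ : ∀ {m s} {P : Pred (Fin m) 0ℓ} (P? : Decidable P) →
                 (∀ i → P i ⇔ toℕ i < s) → s ≤ m → prefixLength P? ≡ s
prefixLength-≡ {zero}          P? P⇔ z≤n = refl
prefixLength-≡ {suc m} {zero}  P? P⇔ _ with P? zero
... | yes p = contradiction (to (P⇔ zero) p) λ ()
... | no  _ = refl
prefixLength-≡ {suc m} {suc s} P? P⇔ (s≤s s≤m) with P? zero
... | yes _ = cong suc (prefixLength-≡ (λ i → P? (suc i)) P∘suc⇔ s≤m)
  where P∘suc⇔ = λ i → mk⇔ (s<s⁻¹ ∘ to (P⇔ (suc i))) (from (P⇔ (suc i)) ∘ s<s)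
... | no ¬p = contradiction (from (P⇔ zero) z<s) ¬p

module _ {A : Set} where

  AllPairs-resp-⊆ : ∀ {R : A → A → Set} {xs ys} → xs ⊆ ys → AllPairs R ys → AllPairs R xs
  AllPairs-resp-⊆ []              []         = []
  AllPairs-resp-⊆ (_ ∷ʳ xs⊆ys)    (_ ∷ rys)  = AllPairs-resp-⊆ xs⊆ys rys
  AllPairs-resp-⊆ (refl ∷ xs⊆ys)  (rx ∷ rys) = All-resp-⊆ xs⊆ys rx ∷ AllPairs-resp-⊆ xs⊆ys rys

  AllPairs-∈ : ∀ {R : A → A → Set} → (∀ {x y} → R x y → R y x) → (∀ {x} → R x x) →
               ∀ {xs x y} → AllPairs R xs → x ∈ xs → y ∈ xs → R x y
  AllPairs-∈ R-sym R-refl (_ ∷ _)   (here refl) (here refl) = R-refl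
  AllPairs-∈ R-sym R-refl (rx ∷ _)  (here refl) (there y∈)  = All.lookup rx y∈
  AllPairs-∈ R-sym R-refl (rx ∷ _)  (there x∈)  (here refl) = R-sym (All.lookup rx x∈)
  AllPairs-∈ R-sym R-refl (_ ∷ rxs) (there x∈)  (there y∈)  = AllPairs-∈ R-sym R-refl rxs x∈ y∈

  AllPairs-lookup : ∀ {R : A → A → Set} {xs} → AllPairs R xs →
                    ∀ {i j} → i Fin.< j → R (lookup xs i) (lookup xs j)
  AllPairs-lookup (rx ∷ _)   {zero}  {suc j} _         = All.lookup rx (∈-lookup j)
  AllPairs-lookup (_ ∷ rxs)  {suc i} {suc j} (s<s i<j) = AllPairs-lookup rxs i<j

  module _ {P : Pred A 0ℓ} (P? : Decidable P) where

    takeWhile-++ : ∀ {xs ys} → All P xs → All (∁ P) ys → takeWhile P? (xs ++ ys) ≡ xs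
    takeWhile-++ []         []          = refl
    takeWhile-++ []         (¬py ∷ _)   rewrite dec-false (P? _) ¬py = refl
    takeWhile-++ (px ∷ pxs) ¬pys        rewrite dec-true (P? _) px = cong (_ ∷_) (takeWhile-++ pxs ¬pys)

    dropWhile-++ : ∀ {xs ys} → All P xs → All (∁ P) ys → dropWhile P? (xs ++ ys) ≡ ys
    dropWhile-++ []         []          = refl
    dropWhile-++ []         (¬py ∷ _)   rewrite dec-false (P? _) ¬py = refl
    dropWhile-++ (px ∷ pxs) ¬pys        rewrite dec-true (P? _) px = dropWhile-++ pxs ¬pys

  module _ {P Q : Pred A 0ℓ} (P? : Decidable P) (Q? : Decidable Q) (P⊆Q : ∀ {x} → P x → Q x) where

    length-filter-≤ : ∀ xs → length (filter P? xs) ≤ length (filter Q? xs)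
    length-filter-≤ []       = z≤n
    length-filter-≤ (y ∷ ys) with P? y | Q? y
    ... | yes _ | yes _  = s≤s (length-filter-≤ ys)
    ... | yes p | no ¬q  = contradiction (P⊆Q p) ¬q
    ... | no _  | yes _  = ℕ.m≤n⇒m≤1+n (length-filter-≤ ys)
    ... | no _  | no _   = length-filter-≤ ys

    length-filter-< : ∀ {x xs} → x ∈ xs → ¬ P x → Q x → length (filter P? xs) < length (filter Q? xs)
    length-filter-< {x} {_ ∷ ys} (here refl) ¬px qx
      rewrite dec-false (P? x) ¬px | dec-true (Q? x) qx = s≤s (length-filter-≤ ys)
    length-filter-< {xs = y ∷ ys} (there x∈) ¬px qx with P? y | Q? y
    ... | yes _ | yes _  = s<s (length-filter-< x∈ ¬px qx)
    ... | yes p | no ¬q  = contradiction (P⊆Q p) ¬q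
    ... | no _  | yes _  = ℕ.m<n⇒m<1+n (length-filter-< x∈ ¬px qx)
    ... | no _  | no _   = length-filter-< x∈ ¬px qx

map-proj-injective : ∀ {A B : Set} {ps qs : List (A × B)} →
                     map proj₁ ps ≡ map proj₁ qs → map proj₂ ps ≡ map proj₂ qs → ps ≡ qs
map-proj-injective {ps = []}    {[]}    _  _  = refl
map-proj-injective {ps = []}    {_ ∷ _} () _
map-proj-injective {ps = _ ∷ _} {[]}    () _
map-proj-injective {ps = _ ∷ _} {_ ∷ _} e₁ e₂ with List.∷-injective e₁ | List.∷-injective e₂
... | refl , e₁′ | refl , e₂′ = cong (_ ∷_) (map-proj-injective e₁′ e₂′)

module _ {A B : Set} {P : Pred B 0ℓ} {Q : Pred A 0ℓ} (P? : Decidable P) (Q? : Decidable Q)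
         (g : A → B) (P∘g⇔Q : ∀ x → P (g x) ⇔ Q x) where

  takeWhile-map : ∀ xs → takeWhile P? (map g xs) ≡ map g (takeWhile Q? xs)
  takeWhile-map []       = refl
  takeWhile-map (x ∷ xs) with does (P? (g x)) | does (Q? x) | does-⇔ (P∘g⇔Q x) (P? (g x)) (Q? x)
  ... | true  | true  | refl = cong (g x ∷_) (takeWhile-map xs)
  ... | false | false | refl = refl

  dropWhile-map : ∀ xs → dropWhile P? (map g xs) ≡ map g (dropWhile Q? xs)
  dropWhile-map []       = refl
  dropWhile-map (x ∷ xs) with does (P? (g x)) | does (Q? x) | does-⇔ (P∘g⇔Q x) (P? (g x)) (Q? x)
  ... | true  | true  | refl = dropWhile-map xs
  ... | false | false | refl = refl

module _ {A : Set} (κ : A → ℕ) where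

  runs : ℕ → (c : ℕ) → List A → Vec (List A) c
  runs b zero    xs = []
  runs b (suc c) xs = takeWhile (λ x → κ x ≟ b) xs ∷ runs (suc b) c (dropWhile (λ x → κ x ≟ b) xs)

  runs-++ : ∀ {b c xs ys} → All (λ x → κ x ≡ b) xs → All (λ y → ¬ κ y ≡ b) ys →
            runs b (suc c) (xs ++ ys) ≡ xs ∷ runs (suc b) c ys
  runs-++ xs≡b ys≢b = cong₂ _∷_ (takeWhile-++ (λ x → κ x ≟ _) xs≡b ys≢b)
                                (cong (runs _ _) (dropWhile-++ (λ x → κ x ≟ _) xs≡b ys≢b))

  dropWhile-≟-keys : ∀ {b xs} → AllPairs (λ x y → κ x ≤ κ y) xs → All (λ x → b ≤ κ x) xs →
                     All (λ x → b < κ x) (dropWhile (λ x → κ x ≟ b) xs)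
  dropWhile-≟-keys {xs = []}    []           []          = []
  dropWhile-≟-keys {b} {x ∷ xs} (x≤ ∷ sorted) (b≤x ∷ b≤) with κ x ≟ b
  ... | yes κx≡b rewrite dec-true (κ x ≟ b) κx≡b = dropWhile-≟-keys sorted b≤
  ... | no κx≢b  rewrite dec-false (κ x ≟ b) κx≢b = b<x ∷ All.map (ℕ.<-≤-trans b<x) x≤
    where b<x = ℕ.≤∧≢⇒< b≤x (κx≢b ∘ sym)

runs-map : ∀ {A B : Set} (g : A → B) (κ : B → ℕ) (κ′ : A → ℕ) → (∀ x → κ (g x) ≡ κ′ x) →
           ∀ b c xs → runs κ b c (map g xs) ≡ Vec.map (map g) (runs κ′ b c xs)
runs-map g κ κ′ κ∘g≡κ′ b zero    xs = refl
runs-map g κ κ′ κ∘g≡κ′ b (suc c) xs =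
  cong₂ _∷_ (takeWhile-map _ _ g same-key xs)
            (trans (cong (runs κ (suc b) c) (dropWhile-map _ _ g same-key xs))
                   (runs-map g κ κ′ κ∘g≡κ′ (suc b) c _))
  where
    same-key : ∀ x → κ (g x) ≡ b ⇔ κ′ x ≡ b
    same-key x = mk⇔ (trans (sym (κ∘g≡κ′ x))) (trans (κ∘g≡κ′ x))

module _ {d : ℕ} {X : Set} where

  record StrictTotalOrders (_≺[_]_ : X → Fin d → X → Set) : Set where
    field
      ≺-irrefl      : ∀ {l x} → ¬ x ≺[ l ] x
      ≺-trans       : ∀ {l x y z} → x ≺[ l ] y → y ≺[ l ] z → x ≺[ l ] z
      ≺-trichotomy  : ∀ l x y → x ≺[ l ] y ⊎ x ≡ y ⊎ y ≺[ l ] x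

    ≺-asym : ∀ {l x y} → x ≺[ l ] y → ¬ y ≺[ l ] x
    ≺-asym x≺y y≺x = ≺-irrefl (≺-trans x≺y y≺x)

    ≺-cmp : ∀ l x y → Tri (x ≺[ l ] y) (x ≡ y) (y ≺[ l ] x)
    ≺-cmp l x y with ≺-trichotomy l x y
    ... | inj₁ x≺y        = tri< x≺y (λ { refl → ≺-irrefl x≺y }) (≺-asym x≺y)
    ... | inj₂ (inj₁ refl) = tri≈ ≺-irrefl refl ≺-irrefl
    ... | inj₂ (inj₂ y≺x) = tri> (≺-asym y≺x) (λ { refl → ≺-irrefl y≺x }) y≺x

    ≺? : ∀ x l y → Dec (x ≺[ l ] y)
    ≺? x l y with ≺-cmp l x y
    ... | tri< x≺y _ _ = yes x≺y
    ... | tri≈ ¬x≺y _ _ = no ¬x≺y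
    ... | tri> ¬x≺y _ _ = no ¬x≺y

  record Avoiding (_≺[_]_ : X → Fin d → X → Set) : Set where
    field
      strictTotalOrders : StrictTotalOrders _≺[_]_
      avoids-21-12 : ∀ {x y i j m} → i Fin.< j → j Fin.< m →
                     x ≺[ i ] y → y ≺[ j ] x → x ≺[ m ] y → ⊥
      avoids-231   : ∀ {a b c i j} → i Fin.< j →
                     a ≺[ i ] b → b ≺[ i ] c → c ≺[ j ] a → a ≺[ j ] b → ⊥

    open StrictTotalOrders strictTotalOrders public

module Encoding {d : ℕ} {X : Set} (_≺[_]_ : X → Fin d → X → Set) (≺? : ∀ x l y → Dec (x ≺[ l ] y)) where

  level : X → X → ℕ
  level r x = prefixLength (λ l → ≺? r l x)

  children : X → List X → Vec (List X) d
  children r = runs (level r) 1 d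

  -- The first argument is fuel; it has to be at least the length of the list.
  encode : ℕ → List X → Tree d
  encode zero    _        = leaf
  encode (suc f) []       = leaf
  encode (suc f) (r ∷ xs) = node (Vec.map (encode f) (children r xs))

module _ {d : ℕ} {X Y : Set}
         {_≺[_]_ : X → Fin d → X → Set} (≺? : ∀ x l y → Dec (x ≺[ l ] y))
         {_⊏[_]_ : Y → Fin d → Y → Set} (⊏? : ∀ x l y → Dec (x ⊏[ l ] y))
         (g : X → Y) (g-iso : ∀ x l y → g x ⊏[ l ] g y ⇔ x ≺[ l ] y) where

  private
    module X = Encoding _≺[_]_ ≺?
    module Y = Encoding _⊏[_]_ ⊏?

  level-map : ∀ r x → Y.level (g r) (g x) ≡ X.level r x
  level-map r x = prefixLength-cong _ _ (λ l → g-iso r l x)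

  encode-map : ∀ f xs → Y.encode f (map g xs) ≡ X.encode f xs
  encode-map zero    xs       = refl
  encode-map (suc f) []       = refl
  encode-map (suc f) (r ∷ xs) = cong node (begin
    Vec.map (Y.encode f) (runs (Y.level (g r)) 1 d (map g xs))
      ≡⟨ cong (Vec.map (Y.encode f)) (runs-map g (Y.level (g r)) (X.level r) (level-map r) 1 d xs) ⟩
    Vec.map (Y.encode f) (Vec.map (map g) (X.children r xs))
      ≡⟨ Vec.map-∘ (Y.encode f) (map g) (X.children r xs) ⟨
    Vec.map (Y.encode f ∘ map g) (X.children r xs)
      ≡⟨ Vec.map-cong (encode-map f) (X.children r xs) ⟩
    Vec.map (X.encode f) (X.children r xs) ∎)
    where open ≡-Reasoning

module Levels {k : ℕ} {X : Set} {_≺[_]_ : X → Fin (suc k) → X → Set}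
            (≺? : ∀ x l y → Dec (x ≺[ l ] y)) (avoiding : Avoiding _≺[_]_) where

  open Avoiding avoiding hiding (≺?)
  open Encoding _≺[_]_ ≺? using (level)

  ≺-prefix-closed : ∀ {u v l m} → u ≺[ zero ] v → l Fin.≤ m → u ≺[ m ] v → u ≺[ l ] v
  ≺-prefix-closed {l = zero}          u≺₀v _   _    = u≺₀v
  ≺-prefix-closed {u} {v} {suc l} {m} u≺₀v l≤m u≺ₘv with ≺-cmp (suc l) u v
  ... | tri< u≺v _ _  = u≺v
  ... | tri≈ _ refl _ = contradiction u≺₀v ≺-irrefl
  ... | tri> _ _ v≺u with ℕ.m≤n⇒m<n∨m≡n l≤m
  ...   | inj₁ l<m = ⊥-elim (avoids-21-12 z<s l<m u≺₀v v≺u u≺ₘv)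
  ...   | inj₂ l≡m with refl ← Fin.toℕ-injective {i = suc l} {j = m} l≡m = contradiction u≺ₘv (≺-asym v≺u)

  module _ {r x : X} (r≺₀x : r ≺[ zero ] x) where

    ≺⇔<level : ∀ l → r ≺[ l ] x ⇔ toℕ l < level r x
    ≺⇔<level = prefixLength-spec (λ l → ≺? r l x) (≺-prefix-closed r≺₀x)

    ≻⇔level≤ : ∀ l → x ≺[ l ] r ⇔ level r x ≤ toℕ l
    ≻⇔level≤ l = mk⇔ (λ x≺r → ℕ.≮⇒≥ (≺-asym x≺r ∘ from (≺⇔<level l))) level≤⇒≻
      where
        level≤⇒≻ : level r x ≤ toℕ l → x ≺[ l ] r
        level≤⇒≻ level≤l with ≺-cmp l r x
        ... | tri< r≺x _ _  = contradiction (to (≺⇔<level l) r≺x) (ℕ.≤⇒≯ level≤l)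
        ... | tri≈ _ refl _ = contradiction r≺₀x ≺-irrefl
        ... | tri> _ _ x≺r  = x≺r

  module _ {r x y : X} (r≺₀x : r ≺[ zero ] x) (r≺₀y : r ≺[ zero ] y) where

    private
      separated₀ : ∀ {j} → x ≺[ j ] r → r ≺[ j ] y → x ≺[ zero ] y
      separated₀ {zero}  x≺₀r _    = contradiction x≺₀r (≺-asym r≺₀x)
      separated₀ {suc j} x≺ⱼr r≺ⱼy with ≺-cmp zero x y
      ... | tri< x≺₀y _ _ = x≺₀y
      ... | tri≈ _ refl _ = contradiction r≺ⱼy (≺-asym x≺ⱼr)
      ... | tri> _ _ y≺₀x = ⊥-elim (avoids-231 z<s r≺₀y y≺₀x x≺ⱼr r≺ⱼy)

    separated : ∀ {j} → x ≺[ j ] r → r ≺[ j ] y → ∀ l → x ≺[ l ] y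
    separated {j} x≺ⱼr r≺ⱼy l with toℕ l ℕ.≤? toℕ j
    ... | yes l≤j = ≺-prefix-closed (separated₀ x≺ⱼr r≺ⱼy) l≤j (≺-trans x≺ⱼr r≺ⱼy)
    ... | no l≰j with ≺-cmp l x y
    ...   | tri< x≺y _ _  = x≺y
    ...   | tri≈ _ refl _ = contradiction r≺ⱼy (≺-asym x≺ⱼr)
    ...   | tri> _ _ y≺x  = ⊥-elim (avoids-231 j<l x≺ⱼr r≺ⱼy y≺x x≺ₗr)
      where
        j<l = ℕ.≰⇒> l≰j
        x≺ₗr = from (≻⇔level≤ r≺₀x l) (ℕ.≤-trans (to (≻⇔level≤ r≺₀x j) x≺ⱼr) (ℕ.<⇒≤ j<l))

    level<⇒≺ : level r x < level r y → ∀ l → x ≺[ l ] y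
    level<⇒≺ lx<ly = separated x≺ⱼr r≺ⱼy
      where
        lx<d = ℕ.<-≤-trans lx<ly (prefixLength-≤ (λ l → ≺? r l y))
        j = fromℕ< lx<d
        toℕj≡lx = Fin.toℕ-fromℕ< lx<d
        x≺ⱼr = from (≻⇔level≤ r≺₀x j) (ℕ.≤-reflexive (sym toℕj≡lx))
        r≺ⱼy = from (≺⇔<level r≺₀y j) (subst (_< level r y) (sym toℕj≡lx) lx<ly)

  level-mono : ∀ {r x y} → r ≺[ zero ] x → r ≺[ zero ] y → x ≺[ zero ] y → level r x ≤ level r y
  level-mono r≺₀x r≺₀y x≺₀y = ℕ.≮⇒≥ (λ ly<lx → ≺-asym x≺₀y (level<⇒≺ r≺₀y r≺₀x ly<lx zero))

  levels-sorted : ∀ {r xs} → All (r ≺[ zero ]_) xs → AllPairs (_≺[ zero ]_) xs →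
                  AllPairs (λ x y → level r x ≤ level r y) xs
  levels-sorted []              []               = []
  levels-sorted (r≺₀x ∷ r≺₀xs) (x≺₀xs ∷ sorted) =
    All.zipWith (λ (r≺₀y , x≺₀y) → level-mono r≺₀x r≺₀y x≺₀y) (r≺₀xs , x≺₀xs) ∷
    levels-sorted r≺₀xs sorted

Path : Set
Path = List ℕ

-- A path lists the labels 1, …, d of the branches leading from the root to a node. A node
-- precedes its descendants in the coordinates below the label of the branch towards them
-- and follows them in the others; nodes in different branches are ordered by branch.
data _⊏[_]_ {d : ℕ} : Path → Fin d → Path → Set where
  []⊏   : ∀ {l s v}     → toℕ l < s → [] ⊏[ l ] (s ∷ v)
  ⊏[]   : ∀ {l s u}     → s ≤ toℕ l → (s ∷ u) ⊏[ l ] []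
  head⊏ : ∀ {l s t u v} → s < t     → (s ∷ u) ⊏[ l ] (t ∷ v)
  tail⊏ : ∀ {l s u v}   → u ⊏[ l ] v → (s ∷ u) ⊏[ l ] (s ∷ v)

module _ {d : ℕ} where

  []⊏⇔ : ∀ {l : Fin d} {s v} → [] ⊏[ l ] (s ∷ v) ⇔ toℕ l < s
  []⊏⇔ = mk⇔ (λ { ([]⊏ l<s) → l<s }) []⊏

  ⊏[]⇔ : ∀ {l : Fin d} {s u} → (s ∷ u) ⊏[ l ] [] ⇔ s ≤ toℕ l
  ⊏[]⇔ = mk⇔ (λ { (⊏[] s≤l) → s≤l }) ⊏[]

  tail⊏⇔ : ∀ {l : Fin d} {s u v} → (s ∷ u) ⊏[ l ] (s ∷ v) ⇔ u ⊏[ l ] v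
  tail⊏⇔ = mk⇔ (λ { (head⊏ s<s′) → contradiction s<s′ (ℕ.<-irrefl refl) ; (tail⊏ u⊏v) → u⊏v }) tail⊏

  head-≤ : ∀ {l : Fin d} {s t u v} → (s ∷ u) ⊏[ l ] (t ∷ v) → s ≤ t
  head-≤ (head⊏ s<t) = ℕ.<⇒≤ s<t
  head-≤ (tail⊏ _)   = ℕ.≤-refl

  ⊏-irrefl : ∀ {l : Fin d} {u} → ¬ u ⊏[ l ] u
  ⊏-irrefl (head⊏ s<s′) = ℕ.<-irrefl refl s<s′
  ⊏-irrefl (tail⊏ u⊏u) = ⊏-irrefl u⊏u

  ⊏-trans : ∀ {l : Fin d} {u v w} → u ⊏[ l ] v → v ⊏[ l ] w → u ⊏[ l ] w
  ⊏-trans ([]⊏ l<s)   (⊏[] s≤l)   = contradiction l<s (ℕ.≤⇒≯ s≤l)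
  ⊏-trans ([]⊏ l<s)   (head⊏ s<t) = []⊏ (ℕ.<-trans l<s s<t)
  ⊏-trans ([]⊏ l<s)   (tail⊏ _)   = []⊏ l<s
  ⊏-trans (⊏[] s≤l)   ([]⊏ l<t)   = head⊏ (ℕ.≤-<-trans s≤l l<t)
  ⊏-trans (head⊏ s<t) (⊏[] t≤l)   = ⊏[] (ℕ.≤-trans (ℕ.<⇒≤ s<t) t≤l)
  ⊏-trans (head⊏ s<t) (head⊏ t<r) = head⊏ (ℕ.<-trans s<t t<r)
  ⊏-trans (head⊏ s<t) (tail⊏ _)   = head⊏ s<t
  ⊏-trans (tail⊏ _)   (⊏[] s≤l)   = ⊏[] s≤l
  ⊏-trans (tail⊏ _)   (head⊏ s<t) = head⊏ s<t
  ⊏-trans (tail⊏ u⊏v) (tail⊏ v⊏w) = tail⊏ (⊏-trans u⊏v v⊏w)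

  ⊏-trichotomy : ∀ (l : Fin d) u v → u ⊏[ l ] v ⊎ u ≡ v ⊎ v ⊏[ l ] u
  ⊏-trichotomy l []      []      = inj₂ (inj₁ refl)
  ⊏-trichotomy l []      (s ∷ v) with toℕ l ℕ.<? s
  ... | yes l<s = inj₁ ([]⊏ l<s)
  ... | no  l≮s = inj₂ (inj₂ (⊏[] (ℕ.≮⇒≥ l≮s)))
  ⊏-trichotomy l (s ∷ u) []      with toℕ l ℕ.<? s
  ... | yes l<s = inj₂ (inj₂ ([]⊏ l<s))
  ... | no  l≮s = inj₁ (⊏[] (ℕ.≮⇒≥ l≮s))
  ⊏-trichotomy l (s ∷ u) (t ∷ v) with ℕ.<-cmp s t
  ... | tri< s<t _ _  = inj₁ (head⊏ s<t)
  ... | tri> _ _ t<s  = inj₂ (inj₂ (head⊏ t<s))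
  ... | tri≈ _ refl _ = Data.Sum.map tail⊏ (Data.Sum.map (cong (s ∷_)) tail⊏) (⊏-trichotomy l u v)

  ⊏-avoids-21-12 : ∀ {u v} {i j m : Fin d} → i Fin.< j → j Fin.< m →
                   u ⊏[ i ] v → v ⊏[ j ] u → u ⊏[ m ] v → ⊥
  ⊏-avoids-21-12 i<j j<m ([]⊏ _)   (⊏[] s≤j) ([]⊏ m<s) = ℕ.<-irrefl refl (ℕ.<-trans j<m (ℕ.<-≤-trans m<s s≤j))
  ⊏-avoids-21-12 i<j j<m (⊏[] s≤i) ([]⊏ j<s) (⊏[] _)   = ℕ.<-irrefl refl (ℕ.<-trans i<j (ℕ.<-≤-trans j<s s≤i))
  ⊏-avoids-21-12 {s ∷ _} {t ∷ _} i<j j<m u⊏v v⊏u u⊏'v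
    with refl ← ℕ.≤-antisym (head-≤ u⊏v) (head-≤ v⊏u)
    = ⊏-avoids-21-12 i<j j<m (to tail⊏⇔ u⊏v) (to tail⊏⇔ v⊏u) (to tail⊏⇔ u⊏'v)

  ⊏-avoids-231 : ∀ {a b c} {i j : Fin d} → i Fin.< j →
                 a ⊏[ i ] b → b ⊏[ i ] c → c ⊏[ j ] a → a ⊏[ j ] b → ⊥
  ⊏-avoids-231 _   ([]⊏ _)   b⊏c       (⊏[] t≤j) ([]⊏ j<s) =
    ℕ.<-irrefl refl (ℕ.<-≤-trans j<s (ℕ.≤-trans (head-≤ b⊏c) t≤j))
  ⊏-avoids-231 _   (⊏[] s≤i) ([]⊏ i<t) c⊏a       _         =
    ℕ.<-irrefl refl (ℕ.<-≤-trans i<t (ℕ.≤-trans (head-≤ c⊏a) s≤i))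
  ⊏-avoids-231 i<j a⊏b       (⊏[] t≤i) ([]⊏ j<s) _         =
    ℕ.<-irrefl refl (ℕ.<-trans (ℕ.<-≤-trans j<s (ℕ.≤-trans (head-≤ a⊏b) t≤i)) i<j)
  ⊏-avoids-231 {s ∷ _} {t ∷ _} {_ ∷ _} i<j a⊏b b⊏c c⊏a a⊏′b
    with refl ← ℕ.≤-antisym (head-≤ a⊏b) (ℕ.≤-trans (head-≤ b⊏c) (head-≤ c⊏a))
       | refl ← ℕ.≤-antisym (head-≤ b⊏c) (ℕ.≤-trans (head-≤ c⊏a) (head-≤ a⊏b))
    = ⊏-avoids-231 i<j (to tail⊏⇔ a⊏b) (to tail⊏⇔ b⊏c) (to tail⊏⇔ c⊏a) (to tail⊏⇔ a⊏′b)

  ⊏-avoiding : Avoiding (_⊏[_]_ {d})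
  ⊏-avoiding = record
    { strictTotalOrders = record { ≺-irrefl = ⊏-irrefl ; ≺-trans = ⊏-trans ; ≺-trichotomy = ⊏-trichotomy }
    ; avoids-21-12 = ⊏-avoids-21-12
    ; avoids-231 = ⊏-avoids-231
    }

⊏? : ∀ {d} u (l : Fin d) v → Dec (u ⊏[ l ] v)
⊏? = Avoiding.≺? ⊏-avoiding

module PathEncoding {d : ℕ} = Encoding (_⊏[_]_ {d}) ⊏?

data LabelIn (lo hi : ℕ) : Path → Set where
  label : ∀ {s w} → lo ≤ s → s < hi → LabelIn lo hi (s ∷ w)

module _ {d : ℕ} where

  open PathEncoding {d}

  mutual
    nodePaths : Tree d → List Path
    nodePaths leaf      = []
    nodePaths (node ts) = [] ∷ childPaths 1 ts

    childPaths : ∀ {c} → ℕ → Vec (Tree d) c → List Path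
    childPaths b []       = []
    childPaths b (t ∷ ts) = map (b ∷_) (nodePaths t) ++ childPaths (suc b) ts

  mutual
    length-nodePaths : ∀ t → length (nodePaths t) ≡ internal t
    length-nodePaths leaf      = refl
    length-nodePaths (node ts) = cong suc (length-childPaths 1 ts)

    length-childPaths : ∀ {c} b (ts : Vec (Tree d) c) → length (childPaths b ts) ≡ internalsV ts
    length-childPaths b []       = refl
    length-childPaths b (t ∷ ts) = begin
      length (map (b ∷_) (nodePaths t) ++ childPaths (suc b) ts)
        ≡⟨ List.length-++ (map (b ∷_) (nodePaths t)) ⟩
      length (map (b ∷_) (nodePaths t)) + length (childPaths (suc b) ts)
        ≡⟨ cong₂ _+_ (trans (List.length-map (b ∷_) (nodePaths t)) (length-nodePaths t))
                     (length-childPaths (suc b) ts) ⟩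
      internal t + internalsV ts ∎
      where open ≡-Reasoning

  childPaths-labels : ∀ {c} b (ts : Vec (Tree d) c) → All (LabelIn b (b + c)) (childPaths b ts)
  childPaths-labels         b []       = []
  childPaths-labels {suc c} b (t ∷ ts) =
    All.++⁺ (All.map⁺ (All.universal (λ _ → label ℕ.≤-refl (ℕ.m<m+n b z<s)) (nodePaths t)))
            (All.map (λ { (label {s} b<s s<) → label (ℕ.<⇒≤ b<s) (subst (s <_) (sym (ℕ.+-suc b c)) s<) })
                     (childPaths-labels (suc b) ts))

  level-[] : ∀ {s w} → s ≤ d → level [] (s ∷ w) ≡ s
  level-[] = prefixLength-≡ _ (λ l → []⊏⇔)

  mutual
    encode-nodePaths : ∀ f t → length (nodePaths t) ≤ f → encode f (nodePaths t) ≡ t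
    encode-nodePaths zero    leaf      _         = refl
    encode-nodePaths (suc f) leaf      _         = refl
    encode-nodePaths (suc f) (node ts) (s≤s len) = cong node (encode-childPaths f 1 ts ℕ.≤-refl len)

    encode-childPaths : ∀ f {c} b (ts : Vec (Tree d) c) → b + c ≤ suc d → length (childPaths b ts) ≤ f →
                        Vec.map (encode f) (runs (level []) b c (childPaths b ts)) ≡ ts
    encode-childPaths f         b []       _    _   = refl
    encode-childPaths f {suc c} b (t ∷ ts) b+c≤ len = begin
      Vec.map (encode f) (runs (level []) b (suc c) (map (b ∷_) (nodePaths t) ++ childPaths (suc b) ts))
        ≡⟨ cong (Vec.map (encode f)) (runs-++ (level []) first-level-b rest-level-≢b) ⟩
      encode f (map (b ∷_) (nodePaths t)) ∷ Vec.map (encode f) (runs (level []) (suc b) c (childPaths (suc b) ts))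
        ≡⟨ cong₂ _∷_ (trans (encode-map ⊏? ⊏? (b ∷_) (λ _ _ _ → tail⊏⇔) f (nodePaths t))
                            (encode-nodePaths f t first-length))
                     (encode-childPaths f (suc b) ts 1+b+c≤ rest-length) ⟩
      t ∷ ts ∎
      where
        open ≡-Reasoning
        1+b+c≤ : suc b + c ≤ suc d
        1+b+c≤ = subst (_≤ suc d) (ℕ.+-suc b c) b+c≤
        label≤d : ∀ {s} → s < suc b + c → s ≤ d
        label≤d s< = ℕ.≤-pred (ℕ.<-≤-trans s< 1+b+c≤)
        first-level-b : All (λ u → level [] u ≡ b) (map (b ∷_) (nodePaths t))
        first-level-b = All.map⁺ (All.universal (λ _ → level-[] (label≤d (s≤s (ℕ.m≤m+n b c)))) _)
        rest-level-≢b : All (λ u → ¬ level [] u ≡ b) (childPaths (suc b) ts)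
        rest-level-≢b = All.map (λ { (label b<s s<) → ℕ.>⇒≢ (subst (b <_) (sym (level-[] (label≤d s<))) b<s) })
                                (childPaths-labels (suc b) ts)
        first-length : length (nodePaths t) ≤ f
        first-length = ℕ.≤-trans (ℕ.≤-reflexive (sym (List.length-map (b ∷_) (nodePaths t))))
                                 (ℕ.≤-trans (List.length-++-≤ˡ (map (b ∷_) (nodePaths t))) len)
        rest-length : length (childPaths (suc b) ts) ≤ f
        rest-length = ℕ.≤-trans (List.length-++-≤ʳ (childPaths (suc b) ts) {map (b ∷_) (nodePaths t)}) len

module _ {k : ℕ} where

  mutual
    nodePaths-sorted : (t : Tree (suc k)) → AllPairs (_⊏[ zero {k} ]_) (nodePaths t)
    nodePaths-sorted leaf      = []
    nodePaths-sorted (node ts) =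
      All.map (λ { (label 1≤s _) → []⊏ 1≤s }) (childPaths-labels 1 ts) ∷ childPaths-sorted 1 ts

    childPaths-sorted : ∀ {c} b (ts : Vec (Tree (suc k)) c) → AllPairs (_⊏[ zero {k} ]_) (childPaths b ts)
    childPaths-sorted b []       = []
    childPaths-sorted b (t ∷ ts) =
      AllPairs.++⁺ (AllPairs.map⁺ (AllPairs.map tail⊏ (nodePaths-sorted t))) (childPaths-sorted (suc b) ts)
                   (All.map⁺ (All.universal (λ _ → All.map (λ { (label b<s _) → head⊏ b<s })
                                                           (childPaths-labels (suc b) ts))
                                            (nodePaths t)))

module _ {k : ℕ} {X : Set} (_≺[_]_ : X → Fin (suc k) → X → Set) where

  Agree : X × Path → X × Path → Set
  Agree (x , u) (y , v) = ∀ l → (x ≺[ l ] y ⇔ u ⊏[ l ] v) × (y ≺[ l ] x ⇔ v ⊏[ l ] u)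

  record Matching (xs : List X) (us : List Path) : Set where
    field
      pairs   : List (X × Path)
      firsts  : map proj₁ pairs ≡ xs
      seconds : map proj₂ pairs ≡ us
      agree   : AllPairs Agree pairs

  matching-length : ∀ {xs us} → Matching xs us → length xs ≡ length us
  matching-length {xs} {us} m = begin
    length xs                ≡⟨ cong length firsts ⟨
    length (map proj₁ pairs) ≡⟨ List.length-map proj₁ pairs ⟩
    length pairs             ≡⟨ List.length-map proj₂ pairs ⟨
    length (map proj₂ pairs) ≡⟨ cong length seconds ⟩
    length us                ∎
    where open ≡-Reasoning; open Matching m

module Matchings {k : ℕ} {X : Set} {_≺[_]_ : X → Fin (suc k) → X → Set}
                 (≺? : ∀ x l y → Dec (x ≺[ l ] y)) (avoiding : Avoiding _≺[_]_) where

  open Avoiding avoiding hiding (≺?)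
  open Encoding _≺[_]_ ≺?
  open Levels ≺? avoiding
  open Matching

  private
    _≺₀_ : X → X → Set
    x ≺₀ y = x ≺[ zero ] y

  Labelled : X → X × Path → Set
  Labelled r (x , u) = ∃[ w ] u ≡ level r x ∷ w

  All-firsts : ∀ {P : X → Set} {xs us} (m : Matching _≺[_]_ xs us) → All P xs → All (P ∘ proj₁) (pairs m)
  All-firsts m Pxs = All.map⁻ (subst (All _) (sym (firsts m)) Pxs)

  agreement : ∀ {xs us x y u v} (m : Matching _≺[_]_ xs us) → (x , u) ∈ pairs m → (y , v) ∈ pairs m →
              ∀ l → x ≺[ l ] y ⇔ u ⊏[ l ] v
  agreement m x∈ y∈ l = proj₁ (AllPairs-∈ (λ x~y l → swap (x~y l)) agree-refl (agree m) x∈ y∈ l)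
    where
      agree-refl : ∀ {p} → Agree _≺[_]_ p p
      agree-refl l = irrefl⇔ , irrefl⇔
        where irrefl⇔ = mk⇔ (⊥-elim ∘ ≺-irrefl) (⊥-elim ∘ ⊏-irrefl)

  agree-∷ : ∀ {x y u v s} → Agree _≺[_]_ (x , u) (y , v) → Agree _≺[_]_ (x , s ∷ u) (y , s ∷ v)
  agree-∷ x~y l = ⇔-sym tail⊏⇔ ⇔-∘ proj₁ (x~y l) , ⇔-sym tail⊏⇔ ⇔-∘ proj₂ (x~y l)

  precedes⇒agree : ∀ {x y u v} → (∀ l → x ≺[ l ] y) → (∀ l → u ⊏[ l ] v) → Agree _≺[_]_ (x , u) (y , v)
  precedes⇒agree x≺y u⊏v l =
    mk⇔ (λ _ → u⊏v l) (λ _ → x≺y l) ,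
    mk⇔ (λ y≺x → contradiction y≺x (≺-asym (x≺y l)))
        (λ v⊏u → contradiction v⊏u (Avoiding.≺-asym ⊏-avoiding (u⊏v l)))

  root-agree : ∀ {r x w} → r ≺₀ x → Agree _≺[_]_ (r , []) (x , level r x ∷ w)
  root-agree r≺₀x l = ⇔-sym []⊏⇔ ⇔-∘ ≺⇔<level r≺₀x l , ⇔-sym ⊏[]⇔ ⇔-∘ ≻⇔level≤ r≺₀x l

  matching-[] : Matching _≺[_]_ [] []
  matching-[] = record { pairs = [] ; firsts = refl ; seconds = refl ; agree = [] }

  matching-∷ : ∀ {r xs us} → All (r ≺₀_) xs → (m : Matching _≺[_]_ xs us) → All (Labelled r) (pairs m) →
               Matching _≺[_]_ (r ∷ xs) ([] ∷ us)
  matching-∷ {r} r≺₀xs m labelled = record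
    { pairs   = (r , []) ∷ pairs m
    ; firsts  = cong (r ∷_) (firsts m)
    ; seconds = cong ([] ∷_) (seconds m)
    ; agree   = All.zipWith (λ { (r≺₀x , _ , refl) → root-agree r≺₀x }) (All-firsts m r≺₀xs , labelled) ∷ agree m
    }

  matching-++ : ∀ {r b xs ys us vs} →
                All (λ x → r ≺₀ x × level r x ≡ b) xs → (mx : Matching _≺[_]_ xs us) →
                All (λ y → r ≺₀ y × b < level r y) ys → (my : Matching _≺[_]_ ys vs) →
                All (Labelled r) (pairs my) →
                Σ[ m ∈ Matching _≺[_]_ (xs ++ ys) (map (b ∷_) us ++ vs) ] All (Labelled r) (pairs m)
  matching-++ {r} {b} {xs} {ys} {us} {vs} xs-level mx ys-level my ys-labelled =
    record
      { pairs   = map (map₂ (b ∷_)) (pairs mx) ++ pairs my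
      ; firsts  = begin
          map proj₁ (map (map₂ (b ∷_)) (pairs mx) ++ pairs my)
            ≡⟨ List.map-++ proj₁ (map (map₂ (b ∷_)) (pairs mx)) (pairs my) ⟩
          map proj₁ (map (map₂ (b ∷_)) (pairs mx)) ++ map proj₁ (pairs my)
            ≡⟨ cong (_++ _) (List.map-∘ (pairs mx)) ⟨
          map proj₁ (pairs mx) ++ map proj₁ (pairs my)
            ≡⟨ cong₂ _++_ (firsts mx) (firsts my) ⟩
          xs ++ ys ∎
      ; seconds = begin
          map proj₂ (map (map₂ (b ∷_)) (pairs mx) ++ pairs my)
            ≡⟨ List.map-++ proj₂ (map (map₂ (b ∷_)) (pairs mx)) (pairs my) ⟩
          map proj₂ (map (map₂ (b ∷_)) (pairs mx)) ++ map proj₂ (pairs my)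
            ≡⟨ cong (_++ _) (List.map-∘ (pairs mx)) ⟨
          map ((b ∷_) ∘ proj₂) (pairs mx) ++ map proj₂ (pairs my)
            ≡⟨ cong₂ _++_ (trans (List.map-∘ (pairs mx)) (cong (map (b ∷_)) (seconds mx))) (seconds my) ⟩
          map (b ∷_) us ++ vs ∎
      ; agree   = AllPairs.++⁺ (AllPairs.map⁺ (AllPairs.map agree-∷ (agree mx))) (agree my)
                               (All.map⁺ (All.map (λ x-info → All.map (cross-agree x-info) y-info) x-info))
      } ,
    All.++⁺ (All.map⁺ (All.map (λ (_ , x≡b) → _ , cong (_∷ _) (sym x≡b)) x-info)) ys-labelled
    where
      open ≡-Reasoning
      x-info = All-firsts mx xs-level
      y-info = All.zip (All-firsts my ys-level , ys-labelled)
      cross-agree : ∀ {x u y v} → r ≺₀ x × level r x ≡ b → (r ≺₀ y × b < level r y) × Labelled r (y , v) →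
                    Agree _≺[_]_ (x , b ∷ u) (y , v)
      cross-agree (r≺₀x , refl) ((r≺₀y , b<y) , _ , refl) =
        precedes⇒agree (level<⇒≺ r≺₀x r≺₀y b<y) (λ _ → head⊏ b<y)

  module _ (r : X) (f : ℕ)
           (block-matching : ∀ ys → AllPairs _≺₀_ ys → length ys ≤ f →
                             Matching _≺[_]_ ys (nodePaths (encode f ys))) where

    runs-matching : ∀ b c xs → b + c ≡ suc (suc k) →
                All (r ≺₀_) xs → All (λ x → b ≤ level r x) xs → AllPairs _≺₀_ xs → length xs ≤ f →
                Σ[ m ∈ Matching _≺[_]_ xs (childPaths b (Vec.map (encode f) (runs (level r) b c xs))) ]
                  All (Labelled r) (pairs m)
    runs-matching b zero [] _ _ _ _ _ = matching-[] , []
    runs-matching b zero (x ∷ _) b+0≡ _ (b≤x ∷ _) _ _ =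
      contradiction (ℕ.≤-trans b≤x (prefixLength-≤ (λ l → ≺? r l x)))
                    (ℕ.<⇒≱ (ℕ.≤-reflexive (trans (sym b+0≡) (ℕ.+-identityʳ b))))
    runs-matching b (suc c) xs b+c≡ r≺₀xs b≤xs sorted len =
      record { pairs = pairs m ; firsts = trans (firsts m) (List.takeWhile++dropWhile P? xs)
             ; seconds = seconds m ; agree = agree m } ,
      proj₂ grafted
      where
        P? = λ x → level r x ≟ b
        run  = takeWhile P? xs
        rest = dropWhile P? xs
        run⊆  = takeWhile-⊆ P? xs
        rest⊆ = dropWhile-⊆ P? xs
        b<rest : All (λ y → b < level r y) rest
        b<rest = dropWhile-≟-keys (level r) (levels-sorted r≺₀xs sorted) b≤xs
        r≺₀rest = All-resp-⊆ rest⊆ r≺₀xs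
        restMatching = runs-matching (suc b) c rest (trans (sym (ℕ.+-suc b c)) b+c≡) r≺₀rest b<rest
                              (AllPairs-resp-⊆ rest⊆ sorted) (ℕ.≤-trans (length-mono-≤ rest⊆) len)
        grafted = matching-++ (All.zip (All-resp-⊆ run⊆ r≺₀xs , All.all-takeWhile P? xs))
                              (block-matching run (AllPairs-resp-⊆ run⊆ sorted) (ℕ.≤-trans (length-mono-≤ run⊆) len))
                              (All.zip (r≺₀rest , b<rest)) (proj₁ restMatching) (proj₂ restMatching)
        m = proj₁ grafted

  encode-matching : ∀ f xs → AllPairs _≺₀_ xs → length xs ≤ f → Matching _≺[_]_ xs (nodePaths (encode f xs))
  encode-matching zero    []         _                  _         = matching-[]
  encode-matching (suc f) []         _                  _         = matching-[]
  encode-matching (suc f) (r ∷ rest) (r≺₀rest ∷ sorted) (s≤s len) =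
    matching-∷ r≺₀rest (proj₁ subtrees) (proj₂ subtrees)
    where
      subtrees = runs-matching r f (encode-matching f) 1 (suc k) rest refl r≺₀rest
                           (All.map (λ r≺₀x → to (≺⇔<level r≺₀x zero) r≺₀x) r≺₀rest) sorted len

lookup-extensionality : ∀ {A : Set} {m} {u v : Vec A m} → (∀ i → Vec.lookup u i ≡ Vec.lookup v i) → u ≡ v
lookup-extensionality {u = u} {v} u≗v =
  trans (sym (Vec.tabulate∘lookup u)) (trans (Vec.tabulate-cong u≗v) (Vec.tabulate∘lookup v))

injective⇒surjective : ∀ {n} (f : Fin n → Fin n) → (∀ {p q} → f p ≡ f q → p ≡ q) → ∀ v → ∃[ p ] f p ≡ v
injective⇒surjective {zero}  f f-inj ()
injective⇒surjective {suc n} f f-inj v with Fin.any? (λ p → f p Fin.≟ v)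
... | yes hit  = hit
... | no  miss = ⊥-elim (collision (Fin.pigeonhole (ℕ.n<1+n n) (λ p → Fin.punchOut (avoids p))))
  where
    avoids : ∀ p → v ≢ f p
    avoids p v≡fp = miss (p , sym v≡fp)
    collision : (∃₂ λ i j → i Fin.< j × Fin.punchOut (avoids i) ≡ Fin.punchOut (avoids j)) → ⊥
    collision (i , j , i<j , same) = Fin.<⇒≢ i<j (f-inj (Fin.punchOut-injective (avoids i) (avoids j) same))

order-embedding-≤ : ∀ {n} (f g : Fin n → Fin n) → (∀ {p q} → f p ≡ f q → p ≡ q) →
                    (∀ {p q} → f p Fin.< f q → g p Fin.< g q) → ∀ p → f p Fin.≤ g p
order-embedding-≤ {n} f g f-inj f<⇒g< p = go (toℕ (f p)) p refl
  where
    go : ∀ m p → toℕ (f p) ≡ m → m ≤ toℕ (g p)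
    go zero    p _      = z≤n
    go (suc m) p fp≡1+m = ℕ.≤-<-trans (go m q toℕfq≡m) (f<⇒g< fq<fp)
      where
        m<n = ℕ.<-trans (ℕ.n<1+n m) (subst (_< n) fp≡1+m (Fin.toℕ<n (f p)))
        preimage = injective⇒surjective f f-inj (fromℕ< m<n)
        q = proj₁ preimage
        toℕfq≡m = trans (cong toℕ (proj₂ preimage)) (Fin.toℕ-fromℕ< m<n)
        fq<fp = subst₂ _<_ (sym toℕfq≡m) (sym fp≡1+m) (ℕ.n<1+n m)

order-determines-permutation : ∀ {n} {f g : Fin n → Fin n} →
                               (∀ {p q} → f p ≡ f q → p ≡ q) → (∀ {p q} → g p ≡ g q → p ≡ q) →
                               (∀ p q → f p Fin.< f q ⇔ g p Fin.< g q) → ∀ p → f p ≡ g p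
order-determines-permutation {f = f} {g} f-inj g-inj same-order p =
  Fin.≤-antisym (order-embedding-≤ f g f-inj (to (same-order _ _)) p)
                (order-embedding-≤ g f g-inj (from (same-order _ _)) p)

module _ {k n : ℕ} where

  CoordLt : DRows (suc k) n → Fin n → Fin (suc k) → Fin n → Set
  CoordLt σ p l q = coord σ l p Fin.< coord σ l q

  coordLt? : ∀ σ p l q → Dec (CoordLt σ p l q)
  coordLt? σ p l q = coord σ l p Fin.<? coord σ l q

  coord-injective : ∀ {σ : DRows (suc k) n} → IsDPerm σ → ∀ l {p q} → coord σ l p ≡ coord σ l q → p ≡ q
  coord-injective σ-perm zero    p≡q = p≡q
  coord-injective σ-perm (suc l) eq  = VecAll.lookup⁺ σ-perm l _ _ eq

  IsAvoidingDPerm : DRows (suc k) n → Set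
  IsAvoidingDPerm σ = IsDPerm σ × ¬ Contains-21-12 σ × ¬ Contains-231 σ

  dperm-avoiding : ∀ {σ} → IsAvoidingDPerm σ → Avoiding (CoordLt σ)
  dperm-avoiding {σ} (σ-perm , ¬21-12 , ¬231) = record
    { strictTotalOrders = record
      { ≺-irrefl     = Fin.<-irrefl refl
      ; ≺-trans      = Fin.<-trans
      ; ≺-trichotomy = trichotomy
      }
    ; avoids-21-12 = λ i<j j<m p≺q q≺p p≺′q → ¬21-12 (_ , _ , _ , _ , _ , i<j , j<m , p≺q , q≺p , p≺′q)
    ; avoids-231   = λ i<j a≺b b≺c c≺a a≺′b → ¬231 (_ , _ , _ , _ , _ , i<j , a≺b , b≺c , c≺a , a≺′b)
    }
    where
      trichotomy : ∀ l p q → CoordLt σ p l q ⊎ p ≡ q ⊎ CoordLt σ q l p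
      trichotomy l p q with Fin.<-cmp (coord σ l p) (coord σ l q)
      ... | tri< p<q _ _ = inj₁ p<q
      ... | tri≈ _ p≡q _ = inj₂ (inj₁ (coord-injective σ-perm l p≡q))
      ... | tri> _ _ q<p = inj₂ (inj₂ q<p)

  orders-determine-dperm : ∀ {σ τ : DRows (suc k) n} → IsDPerm σ → IsDPerm τ →
                           (∀ p l q → CoordLt σ p l q ⇔ CoordLt τ p l q) → σ ≡ τ
  orders-determine-dperm σ-perm τ-perm same-order = lookup-extensionality λ l → lookup-extensionality
    (order-determines-permutation (coord-injective σ-perm (suc l)) (coord-injective τ-perm (suc l))
                                  (λ p q → same-order p (suc l) q))

module Realisation {k : ℕ} {Y : Set} {_⊏[_]_ : Y → Fin (suc k) → Y → Set}
                   (orders : StrictTotalOrders _⊏[_]_)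
                   (ys : List Y) (increasing : AllPairs (_⊏[ zero ]_) ys) where

  open StrictTotalOrders orders

  private
    n = length ys

    y : Fin n → Y
    y = lookup ys

    y-increasing : ∀ {p q} → p Fin.< q → y p ⊏[ zero ] y q
    y-increasing = AllPairs-lookup increasing

    y-injective : ∀ {p q} → y p ≡ y q → p ≡ q
    y-injective {p} {q} yp≡yq with Fin.<-cmp p q
    ... | tri< p<q _ _ = contradiction (subst (y p ⊏[ zero ]_) (sym yp≡yq) (y-increasing p<q)) ≺-irrefl
    ... | tri≈ _ p≡q _ = p≡q
    ... | tri> _ _ q<p = contradiction (subst (y q ⊏[ zero ]_) yp≡yq (y-increasing q<p)) ≺-irrefl

    rank : Fin (suc k) → Y → ℕ
    rank l a = length (filter (λ q → ≺? (y q) l a) (allFin n))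

    rank<n : ∀ l p → rank l (y p) < n
    rank<n l p = subst (rank l (y p) <_) (List.length-tabulate Function.id)
                       (List.filter-notAll _ (allFin n) (Any.map (λ { refl → ≺-irrefl }) (∈-allFin p)))

    rank-mono : ∀ {l p q} → y p ⊏[ l ] y q → rank l (y p) < rank l (y q)
    rank-mono {p = p} yp⊏yq = length-filter-< _ _ (λ yr⊏yp → ≺-trans yr⊏yp yp⊏yq) (∈-allFin p) ≺-irrefl yp⊏yq

  σ : DRows (suc k) n
  σ = Vec.tabulate λ l → Vec.tabulate λ p → fromℕ< (rank<n (suc l) p)

  private
    toℕ-coord : ∀ l p → toℕ (coord σ (suc l) p) ≡ rank (suc l) (y p)
    toℕ-coord l p = begin
      toℕ (Vec.lookup (Vec.lookup σ l) p)
        ≡⟨ cong (λ row → toℕ (Vec.lookup row p)) (Vec.lookup∘tabulate _ l) ⟩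
      toℕ (Vec.lookup (Vec.tabulate λ p → fromℕ< (rank<n (suc l) p)) p)
        ≡⟨ cong toℕ (Vec.lookup∘tabulate _ p) ⟩
      toℕ (fromℕ< (rank<n (suc l) p))
        ≡⟨ Fin.toℕ-fromℕ< (rank<n (suc l) p) ⟩
      rank (suc l) (y p) ∎
      where open ≡-Reasoning

  σ-order : ∀ p l q → CoordLt σ p l q ⇔ y p ⊏[ l ] y q
  σ-order p zero q = mk⇔ y-increasing reflect
    where
      reflect : y p ⊏[ zero ] y q → p Fin.< q
      reflect yp⊏yq with Fin.<-cmp p q
      ... | tri< p<q _ _  = p<q
      ... | tri≈ _ refl _ = contradiction yp⊏yq ≺-irrefl
      ... | tri> _ _ q<p  = contradiction yp⊏yq (≺-asym (y-increasing q<p))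
  σ-order p (suc l) q = mk⇔ reflect (coord-mono p q)
    where
      coord-mono : ∀ p q → y p ⊏[ suc l ] y q → CoordLt σ p (suc l) q
      coord-mono p q yp⊏yq = subst₂ _<_ (sym (toℕ-coord l p)) (sym (toℕ-coord l q)) (rank-mono yp⊏yq)
      reflect : CoordLt σ p (suc l) q → y p ⊏[ suc l ] y q
      reflect p<q with ≺-cmp (suc l) (y p) (y q)
      ... | tri< yp⊏yq _ _ = yp⊏yq
      ... | tri≈ _ yp≡yq _ with refl ← y-injective yp≡yq = contradiction p<q (Fin.<-irrefl refl)
      ... | tri> _ _ yq⊏yp = contradiction p<q (Fin.<-asym (coord-mono q p yq⊏yp))

  σ-isDPerm : IsDPerm σ
  σ-isDPerm = VecAll.lookup⁻ λ l p q → injective (suc l)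
    where
      injective : ∀ l {p q} → coord σ l p ≡ coord σ l q → p ≡ q
      injective l {p} {q} eq with ≺-cmp l (y p) (y q)
      ... | tri< yp⊏yq _ _ = contradiction (from (σ-order p l q) yp⊏yq) (Fin.<-irrefl eq)
      ... | tri≈ _ yp≡yq _ = y-injective yp≡yq
      ... | tri> _ _ yq⊏yp = contradiction (from (σ-order q l p) yq⊏yp) (Fin.<-irrefl (sym eq))

  σ-avoids : Avoiding _⊏[_]_ → ¬ Contains-21-12 σ × ¬ Contains-231 σ
  σ-avoids avoiding =
    (λ (p , q , i , j , m , i<j , j<m , p<q , q<p , p<′q) →
       avoids-21-12 i<j j<m (to (σ-order p i q) p<q) (to (σ-order q j p) q<p) (to (σ-order p m q) p<′q)) ,
    (λ (i , j , a , b , c , i<j , a<b , b<c , c<a , a<′b) →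
       avoids-231 i<j (to (σ-order a i b) a<b) (to (σ-order b i c) b<c) (to (σ-order c j a) c<a) (to (σ-order a j b) a<′b))
    where open Avoiding avoiding using (avoids-21-12; avoids-231)

  encode-σ : Encoding.encode (CoordLt σ) (coordLt? σ) n (allFin n) ≡ Encoding.encode _⊏[_]_ ≺? n ys
  encode-σ = begin
    Encoding.encode (CoordLt σ) (coordLt? σ) n (allFin n)
      ≡⟨ encode-map (coordLt? σ) ≺? y (λ p l q → ⇔-sym (σ-order p l q)) n (allFin n) ⟨
    Encoding.encode _⊏[_]_ ≺? n (map y (allFin n))
      ≡⟨ cong (Encoding.encode _⊏[_]_ ≺? n) (trans (List.map-tabulate Function.id y) (List.tabulate-lookup ys)) ⟩
    Encoding.encode _⊏[_]_ ≺? n ys ∎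
    where open ≡-Reasoning

module _ (k n : ℕ) where

  encodeDPerm : DRows (suc k) n → Tree (suc k)
  encodeDPerm σ = Encoding.encode (CoordLt σ) (coordLt? σ) n (allFin n)

  encodeDPerm-matching : ∀ {σ} → IsAvoidingDPerm σ → Matching (CoordLt σ) (allFin n) (nodePaths (encodeDPerm σ))
  encodeDPerm-matching {σ} valid =
    Matchings.encode-matching (coordLt? σ) (dperm-avoiding valid) n (allFin n)
                              (AllPairs.tabulate⁺-< Function.id) (ℕ.≤-reflexive (List.length-tabulate Function.id))

  internal-encodeDPerm : ∀ {σ} → IsAvoidingDPerm σ → internal (encodeDPerm σ) ≡ n
  internal-encodeDPerm {σ} valid = begin
    internal (encodeDPerm σ)           ≡⟨ length-nodePaths (encodeDPerm σ) ⟨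
    length (nodePaths (encodeDPerm σ)) ≡⟨ matching-length _ (encodeDPerm-matching valid) ⟨
    length (allFin n)                  ≡⟨ List.length-tabulate Function.id ⟩
    n                                  ∎
    where open ≡-Reasoning

  encodeDPerm-injective : ∀ {σ τ} → IsAvoidingDPerm σ → IsAvoidingDPerm τ →
                          encodeDPerm σ ≡ encodeDPerm τ → σ ≡ τ
  encodeDPerm-injective {σ} {τ} σ-valid τ-valid same-tree =
    orders-determine-dperm (proj₁ σ-valid) (proj₁ τ-valid) same-order
    where
      open Matching
      mσ = encodeDPerm-matching σ-valid
      mτ = encodeDPerm-matching τ-valid
      same-pairs : pairs mσ ≡ pairs mτ
      same-pairs = map-proj-injective (trans (firsts mσ) (sym (firsts mτ)))
                                      (trans (seconds mσ) (trans (cong nodePaths same-tree) (sym (seconds mτ))))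
      path : ∀ p → ∃[ u ] (p , u) ∈ pairs mσ
      path p with z , z∈ , refl ← ∈-map⁻ proj₁ (subst (p ∈_) (sym (firsts mσ)) (∈-allFin p)) = proj₂ z , z∈
      same-order : ∀ p l q → CoordLt σ p l q ⇔ CoordLt τ p l q
      same-order p l q =
        ⇔-sym (Matchings.agreement (coordLt? τ) (dperm-avoiding τ-valid) mτ
                                   (in-τ (proj₂ (path p))) (in-τ (proj₂ (path q))) l)
        ⇔-∘ Matchings.agreement (coordLt? σ) (dperm-avoiding σ-valid) mσ (proj₂ (path p)) (proj₂ (path q)) l
        where
          in-τ : ∀ {p u} → (p , u) ∈ pairs mσ → (p , u) ∈ pairs mτ
          in-τ = subst (_ ∈_) same-pairs

encodeDPerm-surjective : ∀ {k n} (t : Tree (suc k)) → length (nodePaths t) ≡ n →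
                         ∃[ σ ] IsAvoidingDPerm σ × encodeDPerm k n σ ≡ t
encodeDPerm-surjective {k} t refl =
  σ , (σ-isDPerm , σ-avoids ⊏-avoiding) , trans encode-σ (encode-nodePaths (length (nodePaths t)) t ℕ.≤-refl)
  where open Realisation (Avoiding.strictTotalOrders ⊏-avoiding) (nodePaths t) (nodePaths-sorted t)

-- The construction works for every d ≥ 1; the hypothesis 2 ≤ d is only used to exclude d = 0.
theorem2 : (d n : ℕ) → 2 ≤ d →
    Bijection (SubsetSetoid (DRows d n) (λ σ → IsDPerm σ × ¬ Contains-21-12 σ × ¬ Contains-231 σ))
              (SubsetSetoid (Tree d) (λ t → internal t ≡ n))
theorem2 zero    n ()
theorem2 (suc k) n _ = record
  { to        = λ (σ , valid) → encodeDPerm k n σ , internal-encodeDPerm k n valid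
  ; cong      = cong (encodeDPerm k n)
  ; bijective = (λ {x} {y} → encodeDPerm-injective k n (proj₂ x) (proj₂ y)) ,
                λ (t , internal≡n) →
                  let σ , valid , encodes-t = encodeDPerm-surjective t (trans (length-nodePaths t) internal≡n)
                  in (σ , valid) , λ σ′≡σ → trans (cong (encodeDPerm k n) σ′≡σ) encodes-t
  }
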